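{- Let $P,Q\in\mathbf{F}_2[X]$ be polynomials, each of which is even or odd. Then $h(PQ)\le h(P)+h(Q)+\varepsilon$, where $\varepsilon=0$ if one of $P,Q$ is even and $\varepsilon=1$ otherwise.
   Context: A polynomial in $\mathbf{F}_2[X]$ is even if it is zero or all its exponents are even; odd if it is nonzero and all its exponents are odd. For an integer $k\ge0$ with binary expansion $k=\sum\beta_i2^i$, $h(k)=\sum_{i\ge1}\beta_i2^{\lfloor (i-1)/2\rfloor}$. For a nonzero even or odd polynomial $P$, $h(P)$ is the maximum of $h(d)$ over the exponents $d$ of $P$; $h(0)=-\infty$ (with $-\infty$ absorbing in sums). -}

module Defs where

open import Data.Bool using (Bool; true; false; if_then_else_; _xor_)
open import Data.List using (List; []; _∷_)
open import Data.Maybe using (Maybe; just; nothing)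
open import Data.Nat using (ℕ; zero; suc; _+_; _*_; _^_; _≤_; _⊔_; _/_; _%_)
open import Data.Product using (_×_)
open import Data.Sum using (_⊎_; inj₁; inj₂)
open import Relation.Binary.PropositionalEquality using (_≡_)
open import Relation.Nullary using (¬_)

-- Polynomials over F₂ : coefficient lists, lowest degree first,
-- true = 1, false = 0 (trailing zeros allowed; all notions below only
-- look at coefficients, so they are invariant under trailing zeros).

Poly : Set
Poly = List Bool

coeff : Poly → ℕ → Bool
coeff []       _       = false
coeff (b ∷ _)  zero    = b
coeff (_ ∷ bs) (suc n) = coeff bs n

_+ₚ_ : Poly → Poly → Poly
[]       +ₚ q        = q
(a ∷ p)  +ₚ []       = a ∷ p
(a ∷ p)  +ₚ (b ∷ q)  = (a xor b) ∷ (p +ₚ q)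

zeroPoly : ℕ → Poly
zeroPoly zero    = []
zeroPoly (suc n) = false ∷ zeroPoly n

_*ₚ_ : Poly → Poly → Poly
[]      *ₚ q = []
(a ∷ p) *ₚ q = (if a then q else []) +ₚ (false ∷ (p *ₚ q))

IsExponent : Poly → ℕ → Set
IsExponent P d = coeff P d ≡ true

IsZeroPoly : Poly → Set
IsZeroPoly P = ∀ d → coeff P d ≡ false

EvenPoly : Poly → Set
EvenPoly P = ∀ d → IsExponent P d → d % 2 ≡ 0

OddPoly : Poly → Set
OddPoly P = ¬ IsZeroPoly P × (∀ d → IsExponent P d → d % 2 ≡ 1)

-- h on integers: h(k) = Σ_{i ≥ 1} β_i 2^⌊(i-1)/2⌋, β_i = i-th binary digit.
-- Digits with index i > k vanish (2^i > k), so summing i = 1..k suffices.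

bit : ℕ → ℕ → ℕ
bit zero    k = k % 2
bit (suc i) k = bit i (k / 2)

hSum : ℕ → ℕ → ℕ
hSum zero    k = 0
hSum (suc i) k = hSum i k + bit (suc i) k * 2 ^ (i / 2)

h : ℕ → ℕ
h k = hSum k k

-- ℕ ∪ {-∞} as Maybe ℕ, nothing = -∞

_⊔∞_ : Maybe ℕ → Maybe ℕ → Maybe ℕ
nothing ⊔∞ y       = y
just x  ⊔∞ nothing = just x
just x  ⊔∞ just y  = just (x ⊔ y)

_+∞_ : Maybe ℕ → Maybe ℕ → Maybe ℕ
nothing +∞ _       = nothing
just _  +∞ nothing = nothing
just x  +∞ just y  = just (x + y)

data _≤∞_ : Maybe ℕ → Maybe ℕ → Set where
  -∞≤ : ∀ {y} → nothing ≤∞ y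
  fin≤ : ∀ {x y} → x ≤ y → just x ≤∞ just y

hPolyAux : ℕ → Poly → Maybe ℕ
hPolyAux i []       = nothing
hPolyAux i (b ∷ bs) = (if b then just (h i) else nothing) ⊔∞ hPolyAux (suc i) bs

hPoly : Poly → Maybe ℕ
hPoly P = hPolyAux 0 P

ε : ∀ (P Q : Poly) → (EvenPoly P ⊎ OddPoly P) → (EvenPoly Q ⊎ OddPoly Q) → ℕ
ε _ _ (inj₂ _) (inj₂ _) = 1
ε _ _ (inj₁ _) _        = 0
ε _ _ (inj₂ _) (inj₁ _) = 0

{-# OPTIONS --safe #-}
-- Every exponent of P Q is a sum a + b of exponents of P and Q, and the parities of
-- the exponents give a % 2 * (b % 2) ≤ ε, so it suffices to show
--   h (a + b) ≤ h a + h b + a % 2 * (b % 2).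
-- Now h k is the sum of the binary digits of ⌊k/2⌋ weighted by w j = 2 ^ ⌊j/2⌋, and these
-- weights satisfy w (j + 1) ≤ 2 * w j: a carry into digit j + 1 never costs more than
-- the two units at digit j it replaces. Adding ⌊a/2⌋ and ⌊b/2⌋ digit by digit therefore
-- gives at most h a + h b plus the weight w 0 = 1 of the carry out of the lowest bits,
-- which is a % 2 * (b % 2).
module Submission where

open import Defs
open import Data.Bool using (true; false; if_then_else_)
open import Data.List using ([]; _∷_)
open import Data.Maybe using (just; nothing)
open import Data.Nat using (ℕ; zero; suc; _+_; _*_; _^_; _≤_; _<_; _/_; _%_; z≤n; s≤s)
open import Data.Nat.Properties
open import Data.Nat.DivMod
open import Data.Nat.Divisibility using (divides-refl)
open import Data.Nat.Solver using (module +-*-Solver)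
open import Data.Product using (∃₂; _×_; _,_)
open import Data.Sum using (_⊎_; inj₁; inj₂)
open import Function using (_∘_)
open import Relation.Binary.PropositionalEquality

open +-*-Solver using (solve; _:+_; _:*_; _:=_; con)

[m+n*2]/2≡m/2+n : ∀ m n → (m + n * 2) / 2 ≡ m / 2 + n
[m+n*2]/2≡m/2+n m n = begin
  (m + n * 2) / 2   ≡⟨ +-distrib-/-∣ʳ m (divides-refl n) ⟩
  m / 2 + n * 2 / 2 ≡⟨ cong (m / 2 +_) (m*n/n≡m n 2) ⟩
  m / 2 + n         ∎
  where open ≡-Reasoning

+-lowBits : ∀ a b c → a + b + c ≡ (a % 2 + b % 2 + c) + (a / 2 + b / 2) * 2
+-lowBits a b c = begin
  a + b + c
    ≡⟨ cong₂ (λ x y → x + y + c) (m≡m%n+[m/n]*n a 2) (m≡m%n+[m/n]*n b 2) ⟩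
  (a % 2 + a / 2 * 2) + (b % 2 + b / 2 * 2) + c
    ≡⟨ solve 5 (λ a₀ a₁ b₀ b₁ c → (a₀ :+ a₁ :* con 2) :+ (b₀ :+ b₁ :* con 2) :+ c
                              := (a₀ :+ b₀ :+ c) :+ (a₁ :+ b₁) :* con 2)
             refl (a % 2) (a / 2) (b % 2) (b / 2) c ⟩
  (a % 2 + b % 2 + c) + (a / 2 + b / 2) * 2
    ∎
  where open ≡-Reasoning

[a+b+c]/2≡a/2+b/2+carry : ∀ a b c → (a + b + c) / 2 ≡ a / 2 + b / 2 + (a % 2 + b % 2 + c) / 2
[a+b+c]/2≡a/2+b/2+carry a b c = begin
  (a + b + c) / 2                             ≡⟨ cong (_/ 2) (+-lowBits a b c) ⟩
  (s + (a / 2 + b / 2) * 2) / 2               ≡⟨ [m+n*2]/2≡m/2+n s (a / 2 + b / 2) ⟩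
  s / 2 + (a / 2 + b / 2)                     ≡⟨ +-comm (s / 2) _ ⟩
  a / 2 + b / 2 + s / 2                       ∎
  where
  open ≡-Reasoning
  s = a % 2 + b % 2 + c

[a+b+c]%2≡[a%2+b%2+c]%2 : ∀ a b c → (a + b + c) % 2 ≡ (a % 2 + b % 2 + c) % 2
[a+b+c]%2≡[a%2+b%2+c]%2 a b c =
  trans (cong (_% 2) (+-lowBits a b c)) ([m+kn]%n≡m%n (a % 2 + b % 2 + c) (a / 2 + b / 2) 2)

bitCarry≡* : ∀ {x y} → x < 2 → y < 2 → (x + y + 0) / 2 ≡ x * y
bitCarry≡* (s≤s z≤n)       (s≤s z≤n)       = refl
bitCarry≡* (s≤s z≤n)       (s≤s (s≤s z≤n)) = refl
bitCarry≡* (s≤s (s≤s z≤n)) (s≤s z≤n)       = refl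
bitCarry≡* (s≤s (s≤s z≤n)) (s≤s (s≤s z≤n)) = refl

weightedBitSum : (ℕ → ℕ) → ℕ → ℕ → ℕ
weightedBitSum w zero    k = 0
weightedBitSum w (suc n) k = k % 2 * w 0 + weightedBitSum (w ∘ suc) n (k / 2)

weightedBitSum-zero : ∀ w n → weightedBitSum w n 0 ≡ 0
weightedBitSum-zero w zero    = refl
weightedBitSum-zero w (suc n) = weightedBitSum-zero (w ∘ suc) n

weightedBitSum-snoc : ∀ w n k → weightedBitSum w (suc n) k ≡ weightedBitSum w n k + bit n k * w n
weightedBitSum-snoc w zero    k = +-identityʳ _
weightedBitSum-snoc w (suc n) k = begin
  k % 2 * w 0 + weightedBitSum (w ∘ suc) (suc n) (k / 2)
    ≡⟨ cong (k % 2 * w 0 +_) (weightedBitSum-snoc (w ∘ suc) n (k / 2)) ⟩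
  k % 2 * w 0 + (weightedBitSum (w ∘ suc) n (k / 2) + bit n (k / 2) * w (suc n))
    ≡⟨ +-assoc (k % 2 * w 0) _ _ ⟨
  weightedBitSum w (suc n) k + bit (suc n) k * w (suc n)
    ∎
  where open ≡-Reasoning

weightedBitSum-extend : ∀ w {n n′} k → k ≤ n → n ≤ n′ → weightedBitSum w n k ≡ weightedBitSum w n′ k
weightedBitSum-extend w {n} {n′} zero _ _ =
  trans (weightedBitSum-zero w n) (sym (weightedBitSum-zero w n′))
weightedBitSum-extend w {suc n} {suc n′} (suc k) (s≤s k≤n) (s≤s n≤n′) =
  cong (suc k % 2 * w 0 +_) (weightedBitSum-extend (w ∘ suc) (suc k / 2) half≤n n≤n′)
  where
  half≤n : suc k / 2 ≤ n
  half≤n = ≤-pred (≤-trans (m/n<m (suc k) 2 (s≤s (s≤s z≤n))) (s≤s k≤n))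

weightedBitSum-+-≤ : ∀ w → (∀ j → w (suc j) ≤ 2 * w j) → ∀ n a b c →
  weightedBitSum w n (a + b + c) ≤ weightedBitSum w n a + weightedBitSum w n b + c * w 0
weightedBitSum-+-≤ w w-growth zero    a b c = z≤n
weightedBitSum-+-≤ w w-growth (suc n) a b c = begin
  (a + b + c) % 2 * w 0 + W′ ((a + b + c) / 2)
    ≡⟨ cong₂ (λ r q → r * w 0 + W′ q) ([a+b+c]%2≡[a%2+b%2+c]%2 a b c) ([a+b+c]/2≡a/2+b/2+carry a b c) ⟩
  s % 2 * w 0 + W′ (a / 2 + b / 2 + s / 2)
    ≤⟨ +-monoʳ-≤ (s % 2 * w 0) (weightedBitSum-+-≤ (w ∘ suc) (w-growth ∘ suc) n (a / 2) (b / 2) (s / 2)) ⟩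
  s % 2 * w 0 + (A + B + s / 2 * w 1)
    ≤⟨ +-monoʳ-≤ (s % 2 * w 0) (+-monoʳ-≤ (A + B) (*-monoʳ-≤ (s / 2) (w-growth 0))) ⟩
  s % 2 * w 0 + (A + B + s / 2 * (2 * w 0))
    ≡⟨ solve 5 (λ r q x A B → r :* x :+ (A :+ B :+ q :* (con 2 :* x))
                            := (r :+ q :* con 2) :* x :+ A :+ B)
             refl (s % 2) (s / 2) (w 0) A B ⟩
  (s % 2 + s / 2 * 2) * w 0 + A + B
    ≡⟨ cong (λ t → t * w 0 + A + B) (m≡m%n+[m/n]*n s 2) ⟨
  (a % 2 + b % 2 + c) * w 0 + A + B
    ≡⟨ solve 6 (λ a₀ b₀ c x A B → (a₀ :+ b₀ :+ c) :* x :+ A :+ B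
                               := (a₀ :* x :+ A) :+ (b₀ :* x :+ B) :+ c :* x)
             refl (a % 2) (b % 2) c (w 0) A B ⟩
  weightedBitSum w (suc n) a + weightedBitSum w (suc n) b + c * w 0
    ∎
  where
  open ≤-Reasoning
  W′ = weightedBitSum (w ∘ suc) n
  s = a % 2 + b % 2 + c
  A = W′ (a / 2)
  B = W′ (b / 2)

hWeight : ℕ → ℕ
hWeight j = 2 ^ (j / 2)

hWeight-growth : ∀ j → hWeight (suc j) ≤ 2 * hWeight j
hWeight-growth j = ^-monoʳ-≤ 2 (begin
  suc j / 2     ≤⟨ /-monoˡ-≤ 2 (≤-trans (n≤1+n (suc j)) (≤-reflexive (+-comm 2 j))) ⟩
  (j + 2) / 2   ≡⟨ [m+n*2]/2≡m/2+n j 1 ⟩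
  j / 2 + 1     ≡⟨ +-comm (j / 2) 1 ⟩
  suc (j / 2)   ∎)
  where open ≤-Reasoning

hSum≡weightedBitSum : ∀ i k → hSum i k ≡ weightedBitSum hWeight i (k / 2)
hSum≡weightedBitSum zero    k = refl
hSum≡weightedBitSum (suc i) k =
  trans (cong (_+ bit i (k / 2) * hWeight i) (hSum≡weightedBitSum i k))
        (sym (weightedBitSum-snoc hWeight i (k / 2)))

h≡weightedBitSum : ∀ {n} k → k ≤ n → h k ≡ weightedBitSum hWeight n (k / 2)
h≡weightedBitSum k k≤n =
  trans (hSum≡weightedBitSum k k) (weightedBitSum-extend hWeight (k / 2) (m/n≤m k 2) k≤n)

h-+-≤ : ∀ a b → h (a + b) ≤ h a + h b + a % 2 * (b % 2)
h-+-≤ a b = begin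
  h (a + b)
    ≡⟨ h≡weightedBitSum (a + b) ≤-refl ⟩
  W ((a + b) / 2)
    ≡⟨ cong (λ t → W (t / 2)) (+-identityʳ (a + b)) ⟨
  W ((a + b + 0) / 2)
    ≡⟨ cong W ([a+b+c]/2≡a/2+b/2+carry a b 0) ⟩
  W (a / 2 + b / 2 + (a % 2 + b % 2 + 0) / 2)
    ≤⟨ weightedBitSum-+-≤ hWeight hWeight-growth (a + b) (a / 2) (b / 2) _ ⟩
  W (a / 2) + W (b / 2) + (a % 2 + b % 2 + 0) / 2 * 1
    ≡⟨ cong₂ _+_ (cong₂ _+_ (sym (h≡weightedBitSum a (m≤m+n a b))) (sym (h≡weightedBitSum b (m≤n+m b a))))
                 (trans (*-identityʳ _) (bitCarry≡* (m%n<n a 2) (m%n<n b 2))) ⟩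
  h a + h b + a % 2 * (b % 2)
    ∎
  where
  open ≤-Reasoning
  W = weightedBitSum hWeight (a + b)

≤∞-trans : ∀ {x y z} → x ≤∞ y → y ≤∞ z → x ≤∞ z
≤∞-trans -∞≤      _        = -∞≤
≤∞-trans (fin≤ p) (fin≤ q) = fin≤ (≤-trans p q)

m≤∞m⊔∞n : ∀ m n → m ≤∞ (m ⊔∞ n)
m≤∞m⊔∞n nothing  n        = -∞≤
m≤∞m⊔∞n (just m) nothing  = fin≤ ≤-refl
m≤∞m⊔∞n (just m) (just n) = fin≤ (m≤m⊔n m n)

m≤∞n⊔∞m : ∀ m n → m ≤∞ (n ⊔∞ m)
m≤∞n⊔∞m nothing  n        = -∞≤
m≤∞n⊔∞m (just m) nothing  = fin≤ ≤-refl
m≤∞n⊔∞m (just m) (just n) = fin≤ (m≤n⊔m n m)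

⊔∞-lub : ∀ {x y z} → x ≤∞ z → y ≤∞ z → (x ⊔∞ y) ≤∞ z
⊔∞-lub -∞≤      q        = q
⊔∞-lub (fin≤ p) -∞≤      = fin≤ p
⊔∞-lub (fin≤ p) (fin≤ q) = fin≤ (⊔-lub p q)

+∞-mono-≤∞ : ∀ {x x′ y y′} → x ≤∞ x′ → y ≤∞ y′ → (x +∞ y) ≤∞ (x′ +∞ y′)
+∞-mono-≤∞ -∞≤      _        = -∞≤
+∞-mono-≤∞ (fin≤ p) -∞≤      = -∞≤
+∞-mono-≤∞ (fin≤ p) (fin≤ q) = fin≤ (+-mono-≤ p q)

exponent-+ₚ : ∀ P Q d → IsExponent (P +ₚ Q) d → IsExponent P d ⊎ IsExponent Q d
exponent-+ₚ []          Q       d       e = inj₂ e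
exponent-+ₚ (a ∷ P)     []      d       e = inj₁ e
exponent-+ₚ (true ∷ P)  (b ∷ Q) zero    e = inj₁ refl
exponent-+ₚ (false ∷ P) (b ∷ Q) zero    e = inj₂ e
exponent-+ₚ (a ∷ P)     (b ∷ Q) (suc d) e = exponent-+ₚ P Q d e

ExponentSplit : Poly → Poly → ℕ → Set
ExponentSplit P Q d = ∃₂ λ i j → i + j ≡ d × IsExponent P i × IsExponent Q j

exponent-*ₚ : ∀ P Q d → IsExponent (P *ₚ Q) d → ExponentSplit P Q d
exponent-*ₚ (a ∷ P) Q d e with exponent-+ₚ (if a then Q else []) (false ∷ P *ₚ Q) d e
exponent-*ₚ (true ∷ P)  Q d       e | inj₁ eQ = 0 , d , refl , refl , eQ
exponent-*ₚ (false ∷ P) Q d       e | inj₁ ()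
exponent-*ₚ (a ∷ P)     Q zero    e | inj₂ ()
exponent-*ₚ (a ∷ P)     Q (suc d) e | inj₂ eR with exponent-*ₚ P Q d eR
... | i , j , refl , eP , eQ = suc i , j , refl , eP , eQ

h≤hPolyAux : ∀ i R d → IsExponent R d → just (h (i + d)) ≤∞ hPolyAux i R
h≤hPolyAux i (true ∷ R) zero    refl rewrite +-identityʳ i = m≤∞m⊔∞n (just (h i)) (hPolyAux (suc i) R)
h≤hPolyAux i (b ∷ R)    (suc d) e    rewrite +-suc i d =
  ≤∞-trans (h≤hPolyAux (suc i) R d e) (m≤∞n⊔∞m (hPolyAux (suc i) R) (if b then just (h i) else nothing))

hPolyAux-lub : ∀ i R {z} → (∀ d → IsExponent R d → just (h (i + d)) ≤∞ z) → hPolyAux i R ≤∞ z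
hPolyAux-lub i []      bound = -∞≤
hPolyAux-lub i (b ∷ R) {z} bound =
  ⊔∞-lub (lowest b bound)
         (hPolyAux-lub (suc i) R λ d e → subst (λ t → just (h t) ≤∞ z) (+-suc i d) (bound (suc d) e))
  where
  lowest : ∀ b → (∀ d → IsExponent (b ∷ R) d → just (h (i + d)) ≤∞ z) → (if b then just (h i) else nothing) ≤∞ z
  lowest true  bound = subst (λ t → just (h t) ≤∞ z) (+-identityʳ i) (bound 0 refl)
  lowest false _     = -∞≤

parity-*-≤-ε : ∀ P Q (p : EvenPoly P ⊎ OddPoly P) (q : EvenPoly Q ⊎ OddPoly Q) {a b} →
  IsExponent P a → IsExponent Q b → a % 2 * (b % 2) ≤ ε P Q p q
parity-*-≤-ε P Q (inj₁ evenP)      q                     eP eQ rewrite evenP _ eP = z≤n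
parity-*-≤-ε P Q (inj₂ _)          (inj₁ evenQ)      {a} eP eQ rewrite evenQ _ eQ = ≤-reflexive (*-zeroʳ (a % 2))
parity-*-≤-ε P Q (inj₂ (_ , oddP)) (inj₂ (_ , oddQ))     eP eQ rewrite oddP _ eP | oddQ _ eQ = ≤-refl

mainTheorem16 : (P Q : Poly) (p : EvenPoly P ⊎ OddPoly P) (q : EvenPoly Q ⊎ OddPoly Q) →
    hPoly (P *ₚ Q) ≤∞ ((hPoly P +∞ hPoly Q) +∞ just (ε P Q p q))
mainTheorem16 P Q p q = hPolyAux-lub 0 (P *ₚ Q) λ d e → bound (exponent-*ₚ P Q d e)
  where
  bound : ∀ {d} → ExponentSplit P Q d → just (h d) ≤∞ ((hPoly P +∞ hPoly Q) +∞ just (ε P Q p q))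
  bound (a , b , refl , eP , eQ) =
    ≤∞-trans (fin≤ (h-+-≤ a b))
             (+∞-mono-≤∞ (+∞-mono-≤∞ (h≤hPolyAux 0 P a eP) (h≤hPolyAux 0 Q b eQ))
                         (fin≤ (parity-*-≤-ε P Q p q eP eQ)))
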